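{- Let $G$ be a directed graph, $s \in V(G)$ a source vertex, $k \geq 0$ an integer, and $v \in V(G)\setminus\{s\}$. Let $\mathbb{X}(v)$ denote the collection of all important $(s,v)$-separators in $G$ of size at most $k+1$. Let $e$ be an edge of $G$ with $\mathrm{head}(e)=v$ such that $e \notin \bigcup_{X \in \mathbb{X}(v)} X$. Then $G - e$ is a $k$-FTRS of $G$ with respect to $s$, i.e., for every set $F$ of at most $k$ edges of $G$ and every vertex $w \in V(G)$, $w$ is reachable from $s$ in $G-F$ if and only if $w$ is reachable from $s$ in $(G-e)-F$.
   Context: For a set $X$ of edges, $G-X$ is the graph with vertex set $V(G)$ and edge set $E(G)\setminus X$. For disjoint vertex sets $S,T$, an $(S,T)$-cut is a set $X$ of edges such that $G-X$ has no directed path from a vertex of $S$ to a vertex of $T$; its reachability set $R_X$ is the set of vertices reachable from some vertex of $S$ in $G-X$. An $(S,T)$-cut $X$ is an important $(S,T)$-separator if there is no other $(S,T)$-cut $X'$ with $|X'|\le |X|$ and $R_X \subseteq R_{X'}$. An $(s,v)$-separator means an $(\{s\},\{v\})$-separator. A spanning subgraph $H$ of $G$ is a $k$-FTRS of $G$ w.r.t. $s$ if for every set $F$ of at most $k$ edges and every $w\in V(G)$, $w$ is reachable from $s$ in $G-F$ iff it is reachable from $s$ in $H-F$. -}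

module Defs where

open import Data.Nat using (ℕ; _≤_; suc)
open import Data.Fin using (Fin)
open import Data.Fin.Subset using (Subset; _∈_; _∉_; ∣_∣; _∪_; ⁅_⁆)
open import Data.Product using (_×_)
open import Relation.Binary.PropositionalEquality using (_≡_)
open import Relation.Nullary using (¬_)

record Digraph : Set where
  field
    n    : ℕ
    m    : ℕ
    tail : Fin m → Fin n
    head : Fin m → Fin n

open Digraph public

Vertex : Digraph → Set
Vertex G = Fin (n G)

EdgeSet : Digraph → Set
EdgeSet G = Subset (m G)

data Reach (G : Digraph) (X : EdgeSet G) (u : Vertex G) : Vertex G → Set where
  here : Reach G X u u
  step : ∀ {e} → e ∉ X → Reach G X u (tail G e) → Reach G X u (head G e)

IsCut : (G : Digraph) → Vertex G → Vertex G → EdgeSet G → Set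
IsCut G s v X = ¬ Reach G X s v

_⊆R_ : {G : Digraph} {s : Vertex G} → EdgeSet G → EdgeSet G → Set
_⊆R_ {G} {s} X X' = ∀ w → Reach G X s w → Reach G X' s w

IsImportantSep : (G : Digraph) → Vertex G → Vertex G → EdgeSet G → Set
IsImportantSep G s v X =
  IsCut G s v X ×
  (∀ (X' : EdgeSet G) → IsCut G s v X' → ∣ X' ∣ ≤ ∣ X ∣ →
     _⊆R_ {G} {s} X X' → X' ≡ X)

-- H = G - e is a k-FTRS of G w.r.t. s: for every F with |F| ≤ k and
-- every vertex w, reachability from s in G - F and in (G - e) - F agree.
-- ((G - e) - F has the same vertex set and edge set E(G) \ (F ∪ {e}).)
IsFTRS-minus : (G : Digraph) → ℕ → Vertex G → Fin (m G) → Set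
IsFTRS-minus G k s e =
  ∀ (F : EdgeSet G) → ∣ F ∣ ≤ k → ∀ (w : Vertex G) →
    (Reach G F s w → Reach G (F ∪ ⁅ e ⁆) s w) ×
    (Reach G (F ∪ ⁅ e ⁆) s w → Reach G F s w)

-- Suppose deleting F ∪ {e}, with |F| ≤ k, cut v off from s while the tail of e
-- stayed reachable.  Then F ∪ {e} is an (s,v)-cut of size at most k+1, so it is
-- dominated by an important separator X*: |X*| ≤ |F ∪ {e}| and X* leaves at
-- least the same vertices reachable.  By hypothesis e ∉ X*, and the tail of e is
-- still reachable in G - X*, so v is reachable there: a contradiction.  Hence
-- any use of e on an s-path in G - F can be replaced by a path avoiding e.

module Submission where

open import Defs
open import Data.Nat using (ℕ; _≤_; _<_; _∸_; _+_; suc; z≤n; s≤s; _≤?_)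
open import Data.Nat.Properties
  using (≤-trans; +-monoʳ-≤; +-comm; +-suc; <⇒≱; ∸-monoʳ-<)
open import Data.Nat.Induction using (<-wellFounded)
open import Data.Fin using (Fin)
open import Data.Fin.Properties using (any?; all?) renaming (_≟_ to _≟ᶠ_)
open import Data.Fin.Subset
  using (Subset; _∈_; _∉_; _⊆_; _⊂_; _⊃_; ∣_∣; _∪_; ⁅_⁆; inside; outside)
open import Data.Fin.Subset.Properties
  using ( _∈?_; anySubset?; x∈p∪q⁻; p⊆p∪q; q⊆p∪q; x∈⁅x⁆; x∈⁅y⁆⇒x≡y; ∣⁅x⁆∣≡1
        ; ⊆-antisym; p⊆q⇒∣p∣≤∣q∣; p⊂q⇒∣p∣<∣q∣; ∣p∣≤n; ∣p∣≤∣x∷p∣ )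
open import Data.Vec using (_∷_; []; tabulate)
open import Data.Vec.Properties using (≡-dec; []=⇒lookup; lookup⇒[]=; lookup∘tabulate)
open import Data.Bool using (true) renaming (_≟_ to _≟ᵇ_)
open import Data.Product using (Σ-syntax; ∃; _×_; _,_; proj₁; proj₂)
open import Data.Sum using (inj₁; inj₂)
open import Data.Empty using (⊥-elim)
open import Function using (_∘_)
open import Induction.WellFounded using (WellFounded; Acc; acc; module Subrelation)
import Relation.Binary.Construct.On as On
open import Relation.Binary.Definitions using (Decidable)
open import Relation.Binary.PropositionalEquality using (_≡_; _≢_; refl; sym; trans; subst)
open import Relation.Nullary using (¬_; Dec; yes; no; does; proof; ¬?)
open import Relation.Nullary.Decidable
  using (_×-dec_; _→-dec_; decidable-stable; dec-true)
open import Relation.Nullary.Reflects using (Reflects; invert)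

∣p∪q∣≤∣p∣+∣q∣ : ∀ {N} (p q : Subset N) → ∣ p ∪ q ∣ ≤ ∣ p ∣ + ∣ q ∣
∣p∪q∣≤∣p∣+∣q∣ [] [] = z≤n
∣p∪q∣≤∣p∣+∣q∣ (inside ∷ p) (x ∷ q) =
  s≤s (≤-trans (∣p∪q∣≤∣p∣+∣q∣ p q) (+-monoʳ-≤ ∣ p ∣ (∣p∣≤∣x∷p∣ x q)))
∣p∪q∣≤∣p∣+∣q∣ (outside ∷ p) (inside ∷ q) =
  subst (suc ∣ p ∪ q ∣ ≤_) (sym (+-suc ∣ p ∣ ∣ q ∣)) (s≤s (∣p∪q∣≤∣p∣+∣q∣ p q))
∣p∪q∣≤∣p∣+∣q∣ (outside ∷ p) (outside ∷ q) = ∣p∪q∣≤∣p∣+∣q∣ p q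

module _ {N : ℕ} where

  p⊆q∧∣q∣≤∣p∣⇒p≡q : ∀ {p q : Subset N} → p ⊆ q → ∣ q ∣ ≤ ∣ p ∣ → p ≡ q
  p⊆q∧∣q∣≤∣p∣⇒p≡q {p} {q} p⊆q ∣q∣≤∣p∣ = ⊆-antisym p⊆q q⊆p
    where
    q⊆p : q ⊆ p
    q⊆p {x} x∈q = decidable-stable (x ∈? p)
      (λ x∉p → <⇒≱ (p⊂q⇒∣p∣<∣q∣ (p⊆q , x , x∈q , x∉p)) ∣q∣≤∣p∣)

  ⊃-wellFounded : WellFounded (_⊃_ {N})
  ⊃-wellFounded = Subrelation.wellFounded ⊃⇒co-card<
    (On.wellFounded (λ p → N ∸ ∣ p ∣) <-wellFounded)
    where
    ⊃⇒co-card< : ∀ {p q : Subset N} → p ⊃ q → N ∸ ∣ p ∣ < N ∸ ∣ q ∣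
    ⊃⇒co-card< {p} q⊂p = ∸-monoʳ-< (p⊂q⇒∣p∣<∣q∣ q⊂p) (∣p∣≤n p)

  subsetOf : ∀ {P : Fin N → Set} → (∀ i → Dec (P i)) → Subset N
  subsetOf P? = tabulate (does ∘ P?)

  module _ {P : Fin N → Set} (P? : ∀ i → Dec (P i)) {i : Fin N} where

    ∈-subsetOf⁺ : P i → i ∈ subsetOf P?
    ∈-subsetOf⁺ p = lookup⇒[]= i _ (trans (lookup∘tabulate (does ∘ P?) i) (dec-true (P? i) p))

    ∈-subsetOf⁻ : i ∈ subsetOf P? → P i
    ∈-subsetOf⁻ i∈ = invert (subst (Reflects (P i)) does≡true (proof (P? i)))
      where
      does≡true : does (P? i) ≡ true
      does≡true = trans (sym (lookup∘tabulate (does ∘ P?) i)) ([]=⇒lookup i∈)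

module Reachability (G : Digraph) (s : Vertex G) where

  Reach-antitone : ∀ {X Y : EdgeSet G} → X ⊆ Y → ∀ {w} → Reach G Y s w → Reach G X s w
  Reach-antitone X⊆Y here = here
  Reach-antitone X⊆Y (step f∉Y r) = step (f∉Y ∘ X⊆Y) (Reach-antitone X⊆Y r)

  Reach-∪⁅⁆ : ∀ {X : EdgeSet G} {e} →
    (Reach G (X ∪ ⁅ e ⁆) s (tail G e) → Reach G (X ∪ ⁅ e ⁆) s (head G e)) →
    ∀ {w} → Reach G X s w → Reach G (X ∪ ⁅ e ⁆) s w
  Reach-∪⁅⁆ bypass here = here
  Reach-∪⁅⁆ {X} {e} bypass (step {f} f∉X r) with f ≟ᶠ e
  ... | yes refl = bypass (Reach-∪⁅⁆ bypass r)
  ... | no f≢e = step f∉X∪e (Reach-∪⁅⁆ bypass r)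
    where
    f∉X∪e : f ∉ X ∪ ⁅ e ⁆
    f∉X∪e f∈ with x∈p∪q⁻ X ⁅ e ⁆ f∈
    ... | inj₁ f∈X = f∉X f∈X
    ... | inj₂ f∈⁅e⁆ = f≢e (x∈⁅y⁆⇒x≡y e f∈⁅e⁆)

  module _ (X : EdgeSet G) where

    private
      Sound : Subset (n G) → Set
      Sound S = ∀ {w} → w ∈ S → Reach G X s w

      Leaves : Subset (n G) → Fin (m G) → Set
      Leaves S f = f ∉ X × tail G f ∈ S × head G f ∉ S

      Closure : Set
      Closure = Σ[ S ∈ Subset (n G) ] s ∈ S × Sound S × (∀ f → ¬ Leaves S f)

      leaves? : ∀ S f → Dec (Leaves S f)
      leaves? S f = ¬? (f ∈? X) ×-dec tail G f ∈? S ×-dec ¬? (head G f ∈? S)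

      close : ∀ S → s ∈ S → Sound S → Acc _⊃_ S → Closure
      close S s∈S sound (acc grow) with any? (leaves? S)
      ... | no none = S , s∈S , sound , λ f leaves → none (f , leaves)
      ... | yes (f , f∉X , t∈S , h∉S) =
        close (S ∪ ⁅ head G f ⁆) (p⊆p∪q _ s∈S) sound′ (grow S⊂S′)
        where
        sound′ : Sound (S ∪ ⁅ head G f ⁆)
        sound′ w∈ with x∈p∪q⁻ S _ w∈
        ... | inj₁ w∈S = sound w∈S
        ... | inj₂ w∈⁅h⁆ rewrite x∈⁅y⁆⇒x≡y _ w∈⁅h⁆ = step f∉X (sound t∈S)
        S⊂S′ : S ⊂ S ∪ ⁅ head G f ⁆
        S⊂S′ = p⊆p∪q _ , head G f , q⊆p∪q S _ (x∈⁅x⁆ _) , h∉S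

      closure : Closure
      closure = close ⁅ s ⁆ (x∈⁅x⁆ s) sound-⁅s⁆ (⊃-wellFounded _)
        where
        sound-⁅s⁆ : Sound ⁅ s ⁆
        sound-⁅s⁆ w∈ rewrite x∈⁅y⁆⇒x≡y s w∈ = here

    reachSet : Subset (n G)
    reachSet = proj₁ closure

    ∈-reachSet⁻ : ∀ {w} → w ∈ reachSet → Reach G X s w
    ∈-reachSet⁻ with closure
    ... | _ , _ , sound , _ = sound

    ∈-reachSet⁺ : ∀ {w} → Reach G X s w → w ∈ reachSet
    ∈-reachSet⁺ with closure
    ... | S , s∈S , _ , closed = complete
      where
      complete : ∀ {w} → Reach G X s w → w ∈ S
      complete here = s∈S
      complete (step {f} f∉X r) =
        decidable-stable (head G f ∈? S) (λ h∉S → closed f (f∉X , complete r , h∉S))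

    reach? : ∀ w → Dec (Reach G X s w)
    reach? w with w ∈? reachSet
    ... | yes w∈ = yes (∈-reachSet⁻ w∈)
    ... | no w∉ = no (w∉ ∘ ∈-reachSet⁺)

  infix 4 _≼_
  _≼_ : EdgeSet G → EdgeSet G → Set
  _≼_ = _⊆R_ {G} {s}

  _≼?_ : Decidable _≼_
  X ≼? Y = all? (λ w → reach? X w →-dec reach? Y w)

  reachSet-⊂ : ∀ {X Y} → X ≼ Y → ¬ (Y ≼ X) → reachSet X ⊂ reachSet Y
  reachSet-⊂ {X} {Y} X≼Y Y⋠X with any? (λ w → reach? Y w ×-dec ¬? (reach? X w))
  ... | yes (w , rY , ¬rX) =
    ∈-reachSet⁺ Y ∘ X≼Y _ ∘ ∈-reachSet⁻ X , w , ∈-reachSet⁺ Y rY , ¬rX ∘ ∈-reachSet⁻ X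
  ... | no none =
    ⊥-elim (Y⋠X λ w rY → decidable-stable (reach? X w) (λ ¬rX → none (w , rY , ¬rX)))

  IsTight : EdgeSet G → Set
  IsTight X = ∀ {f} → f ∈ X → Reach G X s (tail G f) × ¬ Reach G X s (head G f)

  tight-⊆ : ∀ {X Y} → IsTight X → X ≼ Y → Y ≼ X → X ⊆ Y
  tight-⊆ {X} {Y} tight X≼Y Y≼X {f} f∈X with tight f∈X
  ... | tail-reached , head-unreached = decidable-stable (f ∈? Y)
    (λ f∉Y → head-unreached (Y≼X _ (step f∉Y (X≼Y _ tail-reached))))

  Exits : EdgeSet G → Fin (m G) → Set
  Exits X f = f ∈ X × Reach G X s (tail G f) × ¬ Reach G X s (head G f)

  exits? : ∀ X f → Dec (Exits X f)
  exits? X f = f ∈? X ×-dec reach? X (tail G f) ×-dec ¬? (reach? X (head G f))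

  boundary : EdgeSet G → EdgeSet G
  boundary X = subsetOf (exits? X)

  module _ {X : EdgeSet G} where

    boundary⊆ : boundary X ⊆ X
    boundary⊆ f∈ = proj₁ (∈-subsetOf⁻ (exits? X) f∈)

    boundary-≼ : boundary X ≼ X
    boundary-≼ _ here = here
    boundary-≼ _ (step {f} f∉∂X r) with f ∈? X
    ... | no f∉X = step f∉X (boundary-≼ _ r)
    ... | yes f∈X = decidable-stable (reach? X (head G f))
      (λ ¬rh → f∉∂X (∈-subsetOf⁺ (exits? X) (f∈X , boundary-≼ _ r , ¬rh)))

    boundary-tight : IsTight (boundary X)
    boundary-tight f∈ with ∈-subsetOf⁻ (exits? X) f∈
    ... | _ , rt , ¬rh = Reach-antitone boundary⊆ rt , ¬rh ∘ boundary-≼ _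

  Dominates : EdgeSet G → EdgeSet G → Set
  Dominates Y X = ∣ Y ∣ ≤ ∣ X ∣ × X ≼ Y

  dominates? : Decidable Dominates
  dominates? Y X = ∣ Y ∣ ≤? ∣ X ∣ ×-dec X ≼? Y

  module _ (v : Vertex G) where

    StrictlyDominatingCut : EdgeSet G → EdgeSet G → Set
    StrictlyDominatingCut X Y = IsCut G s v Y × Dominates Y X × Y ≢ X

    strictlyDominatingCut? : ∀ X Y → Dec (StrictlyDominatingCut X Y)
    strictlyDominatingCut? X Y = ¬? (reach? Y v) ×-dec dominates? Y X ×-dec ¬? (≡-dec _≟ᵇ_ Y X)

    -- Pass to the boundary of X (same reachability set, but tight) and, if that is
    -- not important, recurse on a strictly dominating cut: by tightness its
    -- reachability set is strictly larger.
    ∃-important-dominating : ∀ X → IsCut G s v X →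
      Σ[ X* ∈ EdgeSet G ] IsImportantSep G s v X* × Dominates X* X
    ∃-important-dominating X cut = go X cut (⊃-wellFounded _)
      where
      go : ∀ X → IsCut G s v X → Acc _⊃_ (reachSet X) →
        Σ[ X* ∈ EdgeSet G ] IsImportantSep G s v X* × Dominates X* X
      go X cut (acc grow) = improve (anySubset? (strictlyDominatingCut? ∂X))
        where
        ∂X : EdgeSet G
        ∂X = boundary X

        ∂X-dominates : Dominates ∂X X
        ∂X-dominates = p⊆q⇒∣p∣≤∣q∣ boundary⊆ , λ _ → Reach-antitone boundary⊆

        improve : Dec (∃ (StrictlyDominatingCut ∂X)) →
          Σ[ X* ∈ EdgeSet G ] IsImportantSep G s v X* × Dominates X* X
        improve (no none) = ∂X , (cut ∘ boundary-≼ v , important) , ∂X-dominates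
          where
          important : ∀ Y → IsCut G s v Y → ∣ Y ∣ ≤ ∣ ∂X ∣ → ∂X ≼ Y → Y ≡ ∂X
          important Y cutY ∣Y∣≤∣∂X∣ ∂X≼Y = decidable-stable (≡-dec _≟ᵇ_ Y ∂X)
            (λ Y≢∂X → none (Y , cutY , (∣Y∣≤∣∂X∣ , ∂X≼Y) , Y≢∂X))
        improve (yes (Y , cutY , (∣Y∣≤∣∂X∣ , ∂X≼Y) , Y≢∂X)) =
          let X* , important , ∣X*∣≤∣Y∣ , Y≼X* = go Y cutY (grow (reachSet-⊂ X≼Y Y⋠X))
          in X* , important , ≤-trans ∣X*∣≤∣Y∣ (≤-trans ∣Y∣≤∣∂X∣ (proj₁ ∂X-dominates)) ,
             λ w → Y≼X* w ∘ X≼Y w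
          where
          X≼Y : X ≼ Y
          X≼Y w = ∂X≼Y w ∘ proj₂ ∂X-dominates w
          Y⋠X : ¬ (Y ≼ X)
          Y⋠X Y≼X = Y≢∂X (sym (p⊆q∧∣q∣≤∣p∣⇒p≡q
            (tight-⊆ boundary-tight ∂X≼Y (λ w → Reach-antitone boundary⊆ ∘ Y≼X w)) ∣Y∣≤∣∂X∣))

lemma2 : (G : Digraph) (s : Vertex G) (k : ℕ) (v : Vertex G) → ¬ (v ≡ s) →
    (e : Fin (m G)) → head G e ≡ v →
    (∀ (X : EdgeSet G) → IsImportantSep G s v X → ∣ X ∣ ≤ suc k → e ∉ X) →
    IsFTRS-minus G k s e
lemma2 G s k _ _ e refl e∉important F ∣F∣≤k w =
  Reach-∪⁅⁆ bypass , Reach-antitone (p⊆p∪q ⁅ e ⁆)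
  where
  open Reachability G s

  X : EdgeSet G
  X = F ∪ ⁅ e ⁆

  ∣X∣≤1+k : ∣ X ∣ ≤ suc k
  ∣X∣≤1+k = ≤-trans (∣p∪q∣≤∣p∣+∣q∣ F ⁅ e ⁆)
    (subst (λ c → ∣ F ∣ + c ≤ suc k) (sym (∣⁅x⁆∣≡1 e))
      (subst (_≤ suc k) (+-comm 1 ∣ F ∣) (s≤s ∣F∣≤k)))

  bypass : Reach G X s (tail G e) → Reach G X s (head G e)
  bypass reach-tail = decidable-stable (reach? X (head G e)) λ cut →
    let (X* , important , ∣X*∣≤∣X∣ , X≼X*) = ∃-important-dominating (head G e) X cut
        e∉X* = e∉important X* important (≤-trans ∣X*∣≤∣X∣ ∣X∣≤1+k)
    in proj₁ important (step e∉X* (X≼X* _ reach-tail))
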